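{- Let $T$ be a tree with vertex set $\{1,\dotsc,n\}$, $n\ge 3$, with positive edge weights and weighted distances $d_{ij}$. Let $R=[R_{ij}]_{i,j\in\{3,\dotsc,n\}}$ with $R_{ij}=-d_{21}+d_{i1}+d_{2j}-d_{ij}$ for $i\neq j$ and $R_{ii}=-d_{21}+d_{i1}+d_{2i}+\sum_{k=1}^n d_{ik}$. Let $\alpha$ be a vertex on the path $\mathbf{P}_{12}$ between $1$ and $2$. Suppose $\widetilde X$ is a connected component of $T\smallsetminus(\alpha)$ containing neither $1$ nor $2$, and let $u$ be the vertex of $\widetilde X$ adjacent to $\alpha$. Let $X$ be a connected subgraph of $\widetilde X$ containing $u$, and $E=V(X)$. Then the principal submatrix $R[E,E]$ is (symmetric and) positive semidefinite.
   Context: $d_{ij}$ is the sum of edge weights along the path between $i$ and $j$, $d_{ii}=0$. $T\smallsetminus(\alpha)$ is the forest obtained by deleting vertex $\alpha$ and its incident edges. $V(H)$ is the vertex set of a subgraph $H$. For $E\subseteq\{3,\dotsc,n\}$, $R[E,E]$ is the submatrix of $R$ with rows and columns indexed by $E$.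
   Formalization: The edge weights and the distances $d_{ij}$ are rational, and positive semidefiniteness of $R[E,E]$ is tested against rational vectors only. -}

module Defs where

open import Data.Nat using (ℕ; zero; suc; _+_)
open import Data.Fin using (Fin; zero; suc) renaming (_≟_ to _≟ᶠ_)
open import Data.Fin.Subset using (Subset) renaming (_∈_ to _∈ₛ_)
open import Data.Vec using (lookup)
open import Data.Bool using (Bool; true; false; if_then_else_; _∧_)
open import Data.List using (List; []; _∷_; head; last)
open import Data.List.Relation.Unary.All using (All)
open import Data.List.Relation.Unary.Unique.Propositional using (Unique)
open import Data.Maybe using (just)
open import Data.Product using (Σ; ∃; _×_; _,_)
open import Data.Unit using (⊤)
open import Data.Empty using (⊥)
open import Relation.Nullary using (¬_; does)
open import Relation.Binary.PropositionalEquality using (_≡_; _≢_)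
open import Function using (_∘_; _⇔_)
open import Data.Rational using (ℚ; 0ℚ; _≤_; _<_) renaming (_+_ to _+ℚ_; _*_ to _*ℚ_; _-_ to _-ℚ_)

-- Vertices {1,…,n} are represented by Fin n, vertex k ↦ index k-1.
-- Vertex 1 and vertex 2 of the paper:
v₁ : ∀ {m} → Fin (suc (suc m))
v₁ = zero

v₂ : ∀ {m} → Fin (suc (suc m))
v₂ = suc zero

module _ {n : ℕ} (Adj : Fin n → Fin n → Set) where

  Chain : List (Fin n) → Set
  Chain []            = ⊤
  Chain (x ∷ [])      = ⊤
  Chain (x ∷ y ∷ r)   = Adj x y × Chain (y ∷ r)

  Path : Fin n → Fin n → List (Fin n) → Set
  Path i j p = (head p ≡ just i) × (last p ≡ just j) × Chain p × Unique p

  Connected : Set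
  Connected = ∀ i j → ∃ λ p → Path i j p

  HasCycle : Set
  HasCycle = Σ (Fin n) λ x → Σ (Fin n) λ y → Σ (Fin n) λ z → Σ (List (Fin n)) λ r →
    Σ (Fin n) λ w →
      Unique (x ∷ y ∷ z ∷ r) × Chain (x ∷ y ∷ z ∷ r) ×
      (last (x ∷ y ∷ z ∷ r) ≡ just w) × Adj w x

  IsComponentMinus : Fin n → (Fin n → Set) → Set
  IsComponentMinus α C =
    (∃ λ c → C c) ×
    (∀ y → C y → y ≢ α) ×
    (∀ x y → C x → (C y ⇔ (y ≢ α × ∃ λ p → Path x y p × All (_≢ α) p)))

  SpansConnected : Subset n → Set
  SpansConnected E = ∀ x y → x ∈ₛ E → y ∈ₛ E →
    ∃ λ p → Path x y p × All (_∈ₛ E) p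

pathWeight : ∀ {n} → (Fin n → Fin n → ℚ) → List (Fin n) → ℚ
pathWeight w []          = 0ℚ
pathWeight w (x ∷ [])    = 0ℚ
pathWeight w (x ∷ y ∷ r) = w x y +ℚ pathWeight w (y ∷ r)

record IsWeightedTree {n : ℕ} (Adj : Fin n → Fin n → Set) (w : Fin n → Fin n → ℚ) : Set where
  field
    adj-sym    : ∀ i j → Adj i j → Adj j i
    adj-irrefl : ∀ i → ¬ Adj i i
    connected  : Connected Adj
    acyclic    : ¬ HasCycle Adj
    w-sym      : ∀ i j → Adj i j → w i j ≡ w j i
    w-pos      : ∀ i j → Adj i j → 0ℚ < w i j

sumFin : ∀ {k} → (Fin k → ℚ) → ℚ
sumFin {zero}  f = 0ℚ
sumFin {suc k} f = f zero +ℚ sumFin (f ∘ suc)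

-- the matrix R (entries outside {3..n} are irrelevant for the statement)
Rmat : ∀ {m} → (Fin (suc (suc m)) → Fin (suc (suc m)) → ℚ) →
       Fin (suc (suc m)) → Fin (suc (suc m)) → ℚ
Rmat d i j =
  if does (i ≟ᶠ j)
  then ((Data.Rational.- d v₂ v₁) +ℚ d i v₁ +ℚ d v₂ i +ℚ sumFin (λ k → d i k))
  else ((Data.Rational.- d v₂ v₁) +ℚ d i v₁ +ℚ d v₂ j -ℚ d i j)

ind : ∀ {n} → Subset n → Fin n → ℚ → ℚ
ind E i q = if lookup E i then q else 0ℚ

SymmetricOn : ∀ {n} → Subset n → (Fin n → Fin n → ℚ) → Set
SymmetricOn E M = ∀ i j → i ∈ₛ E → j ∈ₛ E → M i j ≡ M j i

-- R[E,E] is positive semidefinite: x^T R[E,E] x ≥ 0 for every x ∈ ℚ^E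
-- (x given as a vector on all vertices, only its E-entries being used)
PSDOn : ∀ {n} → Subset n → (Fin n → Fin n → ℚ) → Set
PSDOn E M = ∀ (x : _ → ℚ) →
  0ℚ ≤ sumFin (λ i → sumFin (λ j → ind E i (ind E j (x i *ℚ M i j *ℚ x j))))

{-# OPTIONS --safe #-}
module Submission where

-- Root the tree at α. For i in the component C, the paths from i to the vertices 1 and 2 both
-- pass through α, and so does the path from 1 to 2; hence off the diagonal
-- R_ij = d_iα + d_αj - d_ij, which is twice the weight of the common part of the paths from
-- i and from j to α. That weight is Σ_v c_v [v ∈ P_i] [v ∈ P_j], where P_i is the path from i
-- to α and c_v the weight of the edge from v towards α. So on C the matrix R is twice a Gram
-- matrix plus the nonnegative diagonal (Σ_k d_ik)_i, and is therefore positive semidefinite.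

open import Defs
open import Algebra.Bundles using (Ring)
open import Data.Bool using (true; false; if_then_else_)
open import Data.Empty using (⊥-elim)
open import Data.Fin using (Fin; zero; suc) renaming (_≟_ to _≟ᶠ_)
open import Data.Fin.Subset using (Subset) renaming (_∈_ to _∈ₛ_)
open import Data.List using (List; []; _∷_; [_])
open import Data.List.Membership.Propositional using (_∈_; _∉_)
import Data.List.Membership.DecPropositional as DecMembership
open import Data.List.Relation.Binary.Subset.Propositional using (_⊆_)
open import Data.List.Relation.Binary.Subset.Propositional.Properties using (∷⁺ʳ; ∈-∷⁺ʳ)
import Data.List.Relation.Unary.All as All
open import Data.List.Relation.Unary.All.Properties using (All¬⇒¬Any; ¬Any⇒All¬)
open import Data.List.Relation.Unary.AllPairs using ([]; _∷_)
open import Data.List.Relation.Unary.Any using (here; there)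
open import Data.List.Relation.Unary.Any.Properties using (singleton⁻)
open import Data.Nat using (ℕ; zero; suc)
open import Data.Product using (∃; ∃₂; _×_; _,_; proj₁; proj₂)
open import Data.Rational using (ℚ; 0ℚ; 1ℚ; _≤_; _-_; -_; _*_; nonNegative; nonPositive)
import Data.Rational.Properties as ℚ
open import Data.Rational.Solver using (module +-*-Solver)
open import Data.Sum as Sum using (_⊎_; inj₁; inj₂)
open import Data.Unit using (tt)
open import Data.Vec using (lookup)
open import Data.Vec.Properties using (lookup⇒[]=)
open import Function using (_∘_; id)
open import Function.Bundles using (Equivalence)
open import Relation.Binary.PropositionalEquality
  using (_≡_; _≢_; refl; sym; trans; cong; cong₂; subst; module ≡-Reasoning)
open import Relation.Nullary using (¬_; Dec; yes; no; does)

open import Algebra.Properties.Semiring.Sum (Ring.semiring ℚ.+-*-ring)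
  using (sum; sum-syntax; sum-cong-≗; sum-replicate-zero; ∑-distrib-+; ∑-comm; *-distribˡ-sum; *-distribʳ-sum)

-- The addition of ℚ is opened only inside the modules below: at the top level _+_ is the
-- addition of ℕ, which the statement of lemma3p4 uses.
module QuadraticForms where
  open import Data.Rational using (_+_)

  sumFin≡sum : ∀ {k} (f : Fin k → ℚ) → sumFin f ≡ sum f
  sumFin≡sum {zero}  f = refl
  sumFin≡sum {suc k} f = cong (f zero +_) (sumFin≡sum (f ∘ suc))

  sum-nonneg : ∀ {k} (f : Fin k → ℚ) → (∀ i → 0ℚ ≤ f i) → 0ℚ ≤ sum f
  sum-nonneg {zero}  f f≥0 = ℚ.≤-refl
  sum-nonneg {suc k} f f≥0 = ℚ.+-mono-≤ (f≥0 zero) (sum-nonneg (f ∘ suc) (f≥0 ∘ suc))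

  *-nonneg : ∀ {p q} → 0ℚ ≤ p → 0ℚ ≤ q → 0ℚ ≤ p * q
  *-nonneg {p} {q} p≥0 q≥0 =
    ℚ.nonNegative⁻¹ _ {{ℚ.nonNeg*nonNeg⇒nonNeg p {{nonNegative p≥0}} q {{nonNegative q≥0}}}}

  square-nonneg : ∀ p → 0ℚ ≤ p * p
  square-nonneg p with ℚ.≤-total 0ℚ p
  ... | inj₁ p≥0 = *-nonneg p≥0 p≥0
  ... | inj₂ p≤0 = ℚ.nonNegative⁻¹ _ {{ℚ.nonPos*nonPos⇒nonPos p {{nonPositive p≤0}} p {{nonPositive p≤0}}}}

  ∑∑-* : ∀ {m n} (f : Fin m → ℚ) (g : Fin n → ℚ) → ∑[ i < m ] ∑[ j < n ] (f i * g j) ≡ sum f * sum g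
  ∑∑-* f g = trans (sum-cong-≗ λ i → sym (*-distribˡ-sum (f i) g)) (sym (*-distribʳ-sum (sum g) f))

  module _ {n : ℕ} where

    quadraticForm : (Fin n → Fin n → ℚ) → (Fin n → ℚ) → ℚ
    quadraticForm M y = ∑[ i < n ] ∑[ j < n ] (y i * M i j * y j)

    PositiveSemidefinite : (Fin n → Fin n → ℚ) → Set
    PositiveSemidefinite M = ∀ y → 0ℚ ≤ quadraticForm M y

    diagonal : (Fin n → ℚ) → Fin n → Fin n → ℚ
    diagonal s i j = if does (i ≟ᶠ j) then s i else 0ℚ

    diagonal-sym : ∀ s i j → diagonal s i j ≡ diagonal s j i
    diagonal-sym s i j with i ≟ᶠ j | j ≟ᶠ i
    ... | yes refl | yes _    = refl
    ... | yes refl | no i≢i   = ⊥-elim (i≢i refl)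
    ... | no i≢j   | yes refl = ⊥-elim (i≢j refl)
    ... | no _     | no _     = refl

    diagonal-psd : ∀ s → (∀ i → 0ℚ ≤ s i) → PositiveSemidefinite (diagonal s)
    diagonal-psd s s≥0 y = sum-nonneg _ λ i → sum-nonneg _ λ j → entry i j
      where
      open +-*-Solver
      entry : ∀ i j → 0ℚ ≤ y i * diagonal s i j * y j
      entry i j with i ≟ᶠ j
      ... | yes refl = subst (0ℚ ≤_)
                         (solve 2 (λ yᵢ sᵢ → sᵢ :* (yᵢ :* yᵢ) := yᵢ :* sᵢ :* yᵢ) refl (y i) (s i))
                         (*-nonneg (s≥0 i) (square-nonneg (y i)))
      ... | no _     = ℚ.≤-reflexive (sym (trans (cong (_* y j) (ℚ.*-zeroʳ (y i))) (ℚ.*-zeroˡ (y j))))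

    psd-+ : ∀ {M N} → PositiveSemidefinite M → PositiveSemidefinite N →
            PositiveSemidefinite (λ i j → M i j + N i j)
    psd-+ {M} {N} M≥0 N≥0 y = subst (0ℚ ≤_) (sym additive) (ℚ.+-mono-≤ (M≥0 y) (N≥0 y))
      where
      open +-*-Solver
      term : (Fin n → Fin n → ℚ) → Fin n → Fin n → ℚ
      term A i j = y i * A i j * y j
      entry : ∀ i j → term (λ i j → M i j + N i j) i j ≡ term M i j + term N i j
      entry i j = solve 4 (λ yᵢ m p yⱼ → yᵢ :* (m :+ p) :* yⱼ := yᵢ :* m :* yⱼ :+ yᵢ :* p :* yⱼ)
                    refl (y i) (M i j) (N i j) (y j)
      additive : quadraticForm (λ i j → M i j + N i j) y ≡ quadraticForm M y + quadraticForm N y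
      additive = trans (sum-cong-≗ λ i → trans (sum-cong-≗ (entry i)) (∑-distrib-+ (term M i) (term N i)))
                       (∑-distrib-+ (λ i → sum (term M i)) (λ i → sum (term N i)))

  ∑-diagonal : ∀ {n} (s : Fin n → ℚ) i → ∑[ v < n ] diagonal s v i ≡ s i
  ∑-diagonal {suc n} s zero    = trans (cong (s zero +_) (sum-replicate-zero n)) (ℚ.+-identityʳ (s zero))
  ∑-diagonal {suc n} s (suc i) = trans (ℚ.+-identityˡ _) (∑-diagonal (s ∘ suc) i)

  gram-psd : ∀ {k n} (c : Fin k → ℚ) (b : Fin k → Fin n → ℚ) → (∀ v → 0ℚ ≤ c v) →
             PositiveSemidefinite (λ i j → ∑[ v < k ] (c v * (b v i * b v j)))
  gram-psd {k} {n} c b c≥0 y = subst (0ℚ ≤_) (sym sum-of-squares)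
    (sum-nonneg _ λ v → *-nonneg (c≥0 v) (square-nonneg (z v)))
    where
    open ≡-Reasoning
    open +-*-Solver
    z : Fin k → ℚ
    z v = ∑[ i < n ] (y i * b v i)
    F : Fin k → Fin n → Fin n → ℚ
    F v i j = c v * (y i * b v i) * (y j * b v j)
    entry : ∀ i j → y i * (∑[ v < k ] (c v * (b v i * b v j))) * y j ≡ ∑[ v < k ] F v i j
    entry i j = begin
      y i * (∑[ v < k ] (c v * (b v i * b v j))) * y j
        ≡⟨ cong (_* y j) (*-distribˡ-sum (y i) (λ v → c v * (b v i * b v j))) ⟩
      (∑[ v < k ] (y i * (c v * (b v i * b v j)))) * y j
        ≡⟨ *-distribʳ-sum (y j) (λ v → y i * (c v * (b v i * b v j))) ⟩
      ∑[ v < k ] (y i * (c v * (b v i * b v j)) * y j)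
        ≡⟨ sum-cong-≗ (λ v → solve 5 (λ yᵢ yⱼ cᵥ bᵢ bⱼ →
                                         yᵢ :* (cᵥ :* (bᵢ :* bⱼ)) :* yⱼ := cᵥ :* (yᵢ :* bᵢ) :* (yⱼ :* bⱼ))
                                 refl (y i) (y j) (c v) (b v i) (b v j)) ⟩
      ∑[ v < k ] F v i j ∎
    square : ∀ v → ∑[ i < n ] ∑[ j < n ] F v i j ≡ c v * (z v * z v)
    square v = begin
      ∑[ i < n ] ∑[ j < n ] F v i j              ≡⟨ ∑∑-* (λ i → c v * (y i * b v i)) (λ j → y j * b v j) ⟩
      (∑[ i < n ] (c v * (y i * b v i))) * z v   ≡⟨ cong (_* z v) (*-distribˡ-sum (c v) (λ i → y i * b v i)) ⟨
      c v * z v * z v                            ≡⟨ ℚ.*-assoc (c v) (z v) (z v) ⟩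
      c v * (z v * z v)                          ∎
    sum-of-squares : quadraticForm (λ i j → ∑[ v < k ] (c v * (b v i * b v j))) y ≡ ∑[ v < k ] (c v * (z v * z v))
    sum-of-squares = begin
      quadraticForm (λ i j → ∑[ v < k ] (c v * (b v i * b v j))) y
        ≡⟨ sum-cong-≗ (λ i → trans (sum-cong-≗ (entry i)) (∑-comm (λ j v → F v i j))) ⟩
      ∑[ i < n ] ∑[ v < k ] ∑[ j < n ] F v i j   ≡⟨ ∑-comm (λ i v → ∑[ j < n ] F v i j) ⟩
      ∑[ v < k ] ∑[ i < n ] ∑[ j < n ] F v i j   ≡⟨ sum-cong-≗ square ⟩
      ∑[ v < k ] (c v * (z v * z v))             ∎

  module _ {n : ℕ} {E : Subset n} {M N : Fin n → Fin n → ℚ}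
           (M≡N : ∀ i j → i ∈ₛ E → j ∈ₛ E → M i j ≡ N i j) where

    symmetricOn-restrict : (∀ i j → N i j ≡ N j i) → SymmetricOn E M
    symmetricOn-restrict N-sym i j i∈E j∈E = trans (M≡N i j i∈E j∈E) (trans (N-sym i j) (sym (M≡N j i j∈E i∈E)))

    psdOn-restrict : PositiveSemidefinite N → PSDOn E M
    psdOn-restrict N≥0 x = subst (0ℚ ≤_) (sym restrict) (N≥0 y)
      where
      y : Fin n → ℚ
      y i = ind E i (x i)
      term : Fin n → Fin n → ℚ
      term i j = ind E i (ind E j (x i * M i j * x j))
      entry : ∀ i j → term i j ≡ y i * N i j * y j
      entry i j with lookup E i in i∈E | lookup E j in j∈E
      ... | true  | true  = cong (λ t → x i * t * x j) (M≡N i j (lookup⇒[]= i E i∈E) (lookup⇒[]= j E j∈E))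
      ... | true  | false = sym (ℚ.*-zeroʳ (x i * N i j))
      ... | false | true  = sym (trans (cong (_* x j) (ℚ.*-zeroˡ (N i j))) (ℚ.*-zeroˡ (x j)))
      ... | false | false = sym (ℚ.*-zeroʳ (0ℚ * N i j))
      restrict : sumFin (λ i → sumFin (term i)) ≡ quadraticForm N y
      restrict = trans (sumFin≡sum (λ i → sumFin (term i)))
                       (sum-cong-≗ λ i → trans (sumFin≡sum (term i)) (sum-cong-≗ (entry i)))

module SimplePaths {n : ℕ} (Adj : Fin n → Fin n → Set) (w : Fin n → Fin n → ℚ) where
  open import Data.Rational using (_+_)
  open DecMembership (_≟ᶠ_ {n}) using (_∈?_)

  weight : List (Fin n) → ℚ
  weight = pathWeight w

  data SimplePath : Fin n → Fin n → List (Fin n) → Set where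
    stop : ∀ {a} → SimplePath a a [ a ]
    step : ∀ {a b c l} → Adj a b → a ∉ l → SimplePath b c l → SimplePath a c (a ∷ l)

  source∈ : ∀ {a c l} → SimplePath a c l → a ∈ l
  source∈ stop         = here refl
  source∈ (step _ _ _) = here refl

  target∈ : ∀ {a c l} → SimplePath a c l → c ∈ l
  target∈ stop         = here refl
  target∈ (step _ _ P) = there (target∈ P)

  weight-step : ∀ {a b c l} → SimplePath b c l → weight (a ∷ l) ≡ w a b + weight l
  weight-step stop         = refl
  weight-step (step _ _ _) = refl

  firstEdge : List (Fin n) → ℚ
  firstEdge (a ∷ b ∷ _) = w a b
  firstEdge _           = 0ℚ

  firstEdge-step : ∀ {a b c l} → SimplePath b c l → firstEdge (a ∷ l) ≡ w a b
  firstEdge-step stop         = refl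
  firstEdge-step (step _ _ _) = refl

  simplePath⇒path : ∀ {a c l} → SimplePath a c l → Path Adj a c l
  simplePath⇒path stop                         = refl , refl , tt , All.[] ∷ []
  simplePath⇒path (step ab a∉l stop)           = refl , refl , (ab , tt) , ¬Any⇒All¬ _ a∉l ∷ All.[] ∷ []
  simplePath⇒path (step ab a∉l P@(step _ _ _)) with simplePath⇒path P
  ... | _ , last≡c , chain , unique = refl , last≡c , (ab , chain) , ¬Any⇒All¬ _ a∉l ∷ unique

  path⇒simplePath : ∀ {a c} l → Path Adj a c l → SimplePath a c l
  path⇒simplePath (_ ∷ [])    (refl , refl , _ , _) = stop
  path⇒simplePath (_ ∷ b ∷ l) (refl , last≡c , (ab , chain) , a∉ ∷ unique) =
    step ab (All¬⇒¬Any a∉) (path⇒simplePath (b ∷ l) (refl , last≡c , chain , unique))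

  concat : ∀ {a k b s t} → SimplePath a k s → SimplePath k b t → (∀ {x} → x ∈ s → x ∈ t → x ≡ k) →
           ∃ λ L → SimplePath a b L × (∀ {x} → x ∈ L → x ∈ s ⊎ x ∈ t) × weight L ≡ weight s + weight t
  concat stop T _ = _ , T , inj₂ , sym (ℚ.+-identityˡ _)
  concat {a} {t = t} (step {b = a′} {l = s} aa′ a∉s S) T s∩t⊆k with concat S T (s∩t⊆k ∘ there)
  ... | L , J , L⊆s∪t , weight-L = a ∷ L , step aa′ a∉L J , aL⊆as∪t , weight-aL
    where
    a∉L : a ∉ L
    a∉L a∈L with L⊆s∪t a∈L
    ... | inj₁ a∈s = a∉s a∈s
    ... | inj₂ a∈t with s∩t⊆k (here refl) a∈t
    ...   | refl = a∉s (target∈ S)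
    aL⊆as∪t : ∀ {x} → x ∈ a ∷ L → x ∈ a ∷ s ⊎ x ∈ t
    aL⊆as∪t (here x≡a)  = inj₁ (here x≡a)
    aL⊆as∪t (there x∈L) = Sum.map₁ there (L⊆s∪t x∈L)
    weight-aL : weight (a ∷ L) ≡ weight (a ∷ s) + weight t
    weight-aL = begin
      weight (a ∷ L)                 ≡⟨ weight-step J ⟩
      w a a′ + weight L              ≡⟨ cong (w a a′ +_) weight-L ⟩
      w a a′ + (weight s + weight t) ≡⟨ ℚ.+-assoc (w a a′) _ _ ⟨
      w a a′ + weight s + weight t   ≡⟨ cong (_+ weight t) (weight-step S) ⟨
      weight (a ∷ s) + weight t      ∎
      where open ≡-Reasoning

  splitAt : ∀ {a c k l} → SimplePath a c l → k ∈ l →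
            ∃₂ λ A B → SimplePath a k A × SimplePath k c B × A ⊆ l × B ⊆ l × weight l ≡ weight A + weight B
  splitAt stop             (here refl) = _ , _ , stop , stop , id , id , refl
  splitAt P@(step _ _ _)   (here refl) = _ , _ , stop , P , ∈-∷⁺ʳ (here refl) (λ ()) , id , sym (ℚ.+-identityˡ _)
  splitAt {a} (step {b = a′} {l = l} aa′ a∉l P) (there k∈l) with splitAt P k∈l
  ... | A , B , PA , PB , A⊆l , B⊆l , weight-l =
    a ∷ A , B , step aa′ (a∉l ∘ A⊆l) PA , PB , ∷⁺ʳ a A⊆l , there ∘ B⊆l , weight-al
    where
    weight-al : weight (a ∷ l) ≡ weight (a ∷ A) + weight B
    weight-al = begin
      weight (a ∷ l)                 ≡⟨ weight-step P ⟩
      w a a′ + weight l              ≡⟨ cong (w a a′ +_) weight-l ⟩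
      w a a′ + (weight A + weight B) ≡⟨ ℚ.+-assoc (w a a′) _ _ ⟨
      w a a′ + weight A + weight B   ≡⟨ cong (_+ weight B) (weight-step PA) ⟨
      weight (a ∷ A) + weight B      ∎
      where open ≡-Reasoning

  firstHit : ∀ {b c l} (L : List (Fin n)) → SimplePath b c l → c ∈ L →
             ∃₂ λ k s → SimplePath b k s × k ∈ L × (∀ {x} → x ∈ s → x ∈ L → x ≡ k) × s ⊆ l
  firstHit L stop c∈L = _ , _ , stop , c∈L , (λ x∈[c] _ → singleton⁻ x∈[c]) , id
  firstHit {b} L (step bb′ b∉l P) c∈L with b ∈? L
  ... | yes b∈L = b , [ b ] , stop , b∈L , (λ x∈[b] _ → singleton⁻ x∈[b]) , ∈-∷⁺ʳ (here refl) (λ ())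
  ... | no b∉L with firstHit L P c∈L
  ...   | k , s , S , k∈L , s∩L⊆k , s⊆l =
          k , b ∷ s , step bb′ (b∉l ∘ s⊆l) S , k∈L , bs∩L⊆k , ∷⁺ʳ b s⊆l
    where
    bs∩L⊆k : ∀ {x} → x ∈ b ∷ s → x ∈ L → x ≡ k
    bs∩L⊆k (here refl) x∈L = ⊥-elim (b∉L x∈L)
    bs∩L⊆k (there x∈s) x∈L = s∩L⊆k x∈s x∈L

  module InTree (tree : IsWeightedTree Adj w) where
    open IsWeightedTree tree

    edge : ∀ {a b} → Adj a b → SimplePath a b (a ∷ b ∷ [])
    edge {a} ab = step ab (λ a∈[b] → adj-irrefl a (subst (Adj a) (sym (singleton⁻ a∈[b])) ab)) stop

    extend : ∀ {a b c l} → SimplePath a b l → Adj b c → c ∉ l →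
             ∃ λ L → SimplePath a c L × (∀ {x} → x ∈ L → x ∈ l ⊎ x ≡ c) × weight L ≡ weight l + w b c
    extend {b = b} {c} {l} P bc c∉l with concat P (edge bc) meet
      where
      meet : ∀ {x} → x ∈ l → x ∈ b ∷ c ∷ [] → x ≡ b
      meet _   (here x≡b)          = x≡b
      meet c∈l (there (here refl)) = ⊥-elim (c∉l c∈l)
    ... | L , J , L⊆l∪bc , weight-L = L , J , L⊆l∪c , trans weight-L (cong (weight l +_) (ℚ.+-identityʳ (w b c)))
      where
      L⊆l∪c : ∀ {x} → x ∈ L → x ∈ l ⊎ x ≡ c
      L⊆l∪c x∈L with L⊆l∪bc x∈L
      ... | inj₁ x∈l                = inj₁ x∈l
      ... | inj₂ (here refl)        = inj₁ (target∈ P)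
      ... | inj₂ (there (here x≡c)) = inj₂ x≡c

    reverse : ∀ {a c l} → SimplePath a c l → ∃ λ L → SimplePath c a L × L ⊆ l × weight L ≡ weight l
    reverse stop = _ , stop , id , refl
    reverse {a} (step {b = b} {l = l} ab a∉l P) with reverse P
    ... | L , R , L⊆l , weight-L with extend R (adj-sym a b ab) (a∉l ∘ L⊆l)
    ...   | La , Ra , La⊆L∪a , weight-La = La , Ra , La⊆al , weight-La≡
      where
      La⊆al : La ⊆ a ∷ l
      La⊆al x∈La with La⊆L∪a x∈La
      ... | inj₁ x∈L  = there (L⊆l x∈L)
      ... | inj₂ refl = here refl
      weight-La≡ : weight La ≡ weight (a ∷ l)
      weight-La≡ = begin
        weight La         ≡⟨ weight-La ⟩
        weight L + w b a  ≡⟨ cong₂ _+_ weight-L (sym (w-sym a b ab)) ⟩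
        weight l + w a b  ≡⟨ ℚ.+-comm (weight l) (w a b) ⟩
        w a b + weight l  ≡⟨ weight-step P ⟨
        weight (a ∷ l)    ∎
        where open ≡-Reasoning

    cycle : ∀ {a b b′ L} → SimplePath b b′ L → b ≢ b′ → a ∉ L → Adj a b → Adj b′ a → HasCycle Adj
    cycle stop b≢b′ = ⊥-elim (b≢b′ refl)
    cycle (step {l = []} _ _ ())
    cycle {a} P@(step {l = y ∷ r} _ _ _) _ a∉L ab b′a with simplePath⇒path P
    ... | _ , last≡b′ , chain , unique =
      a , _ , y , r , _ , ¬Any⇒All¬ _ a∉L ∷ unique , (ab , chain) , last≡b′ , b′a

    -- Two routes leaving a through different neighbours b, b′: follow the first until it meets the
    -- second, then return along the second to b′; with a this closes a cycle.
    simplePath-unique : ∀ {a c p q} → SimplePath a c p → SimplePath a c q → p ≡ q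
    simplePath-unique stop           stop           = refl
    simplePath-unique stop           (step _ a∉q Q) = ⊥-elim (a∉q (target∈ Q))
    simplePath-unique (step _ a∉p P) stop           = ⊥-elim (a∉p (target∈ P))
    simplePath-unique {a} (step {b = b} ab a∉p P) (step {b = b′} ab′ a∉q Q) with b ≟ᶠ b′
    ... | yes refl = cong (a ∷_) (simplePath-unique P Q)
    ... | no b≢b′ with firstHit _ P (target∈ Q)
    ...   | k , s , S , k∈q , s∩q⊆k , s⊆p with splitAt Q k∈q
    ...     | A , _ , QA , _ , A⊆q , _ with reverse QA
    ...       | RA , R , RA⊆A , _ with concat S R (λ x∈s x∈RA → s∩q⊆k x∈s (A⊆q (RA⊆A x∈RA)))
    ...         | L , J , L⊆s∪RA , _ = ⊥-elim (acyclic (cycle J b≢b′ a∉L ab (adj-sym _ _ ab′)))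
      where
      a∉L : a ∉ L
      a∉L a∈L = Sum.[ a∉p ∘ s⊆p , a∉q ∘ A⊆q ∘ RA⊆A ]′ (L⊆s∪RA a∈L)

    weight-nonneg : ∀ {a c l} → SimplePath a c l → 0ℚ ≤ weight l
    weight-nonneg stop          = ℚ.≤-refl
    weight-nonneg (step ab _ P) =
      subst (0ℚ ≤_) (sym (weight-step P)) (ℚ.+-mono-≤ (ℚ.<⇒≤ (w-pos _ _ ab)) (weight-nonneg P))

    firstEdge-nonneg : ∀ {a c l} → SimplePath a c l → 0ℚ ≤ firstEdge l
    firstEdge-nonneg stop          = ℚ.≤-refl
    firstEdge-nonneg (step ab _ P) = subst (0ℚ ≤_) (sym (firstEdge-step P)) (ℚ.<⇒≤ (w-pos _ _ ab))

module TreeMetric {n : ℕ} {Adj : Fin n → Fin n → Set} {w : Fin n → Fin n → ℚ} (tree : IsWeightedTree Adj w)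
                  (d : Fin n → Fin n → ℚ)
                  (d-realised : ∀ i j → ∃ λ p → Path Adj i j p × pathWeight w p ≡ d i j) where
  open import Data.Rational using (_+_)
  open DecMembership (_≟ᶠ_ {n}) using (_∈?_)
  open IsWeightedTree tree
  open SimplePaths Adj w
  open InTree tree
  open QuadraticForms using (diagonal; ∑-diagonal)

  path : Fin n → Fin n → List (Fin n)
  path i j = proj₁ (d-realised i j)

  path-simple : ∀ i j → SimplePath i j (path i j)
  path-simple i j = path⇒simplePath (path i j) (proj₁ (proj₂ (d-realised i j)))

  path-unique : ∀ {i j l} → SimplePath i j l → l ≡ path i j
  path-unique P = simplePath-unique P (path-simple _ _)

  d≡weight : ∀ {i j l} → SimplePath i j l → d i j ≡ weight l
  d≡weight {i} {j} P = trans (sym (proj₂ (proj₂ (d-realised i j)))) (cong weight (sym (path-unique P)))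

  d-self : ∀ i → d i i ≡ 0ℚ
  d-self i = d≡weight stop

  d-sym : ∀ i j → d i j ≡ d j i
  d-sym i j with reverse (path-simple i j)
  ... | _ , R , _ , weight-R = trans (d≡weight (path-simple i j)) (trans (sym weight-R) (sym (d≡weight R)))

  d-nonneg : ∀ i j → 0ℚ ≤ d i j
  d-nonneg i j = subst (0ℚ ≤_) (sym (d≡weight (path-simple i j))) (weight-nonneg (path-simple i j))

  d-split : ∀ {i j k l} → SimplePath i j l → k ∈ l → d i j ≡ d i k + d k j
  d-split P k∈l with splitAt P k∈l
  ... | _ , _ , A , B , _ , _ , weight-l =
    trans (d≡weight P) (trans weight-l (sym (cong₂ _+_ (d≡weight A) (d≡weight B))))

  d-step : ∀ {a b c l} → Adj a b → a ∉ l → SimplePath b c l → d a c ≡ w a b + d b c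
  d-step ab a∉l P = trans (d≡weight (step ab a∉l P)) (trans (weight-step P) (cong (w _ _ +_) (sym (d≡weight P))))

  d-through-cut : ∀ {α C} → IsComponentMinus Adj α C → ∀ {i t} → C i → ¬ C t → d i t ≡ d i α + d α t
  d-through-cut {α} component {i} {t} Ci ¬Ct with α ∈? path i t
  ... | yes α∈p = d-split (path-simple i t) α∈p
  ... | no α∉p  = ⊥-elim (¬Ct (Equivalence.from (proj₂ (proj₂ component) i t Ci)
                    (t≢α , path i t , proj₁ (proj₂ (d-realised i t)) , All.map (_∘ sym) (¬Any⇒All¬ _ α∉p))))
    where
    t≢α : t ≢ α
    t≢α refl = α∉p (target∈ (path-simple i t))

  indicator : Fin n → List (Fin n) → ℚ
  indicator v l = if does (v ∈? l) then 1ℚ else 0ℚ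

  indicator-∷ : ∀ {v x l} → v ≢ x → indicator v (x ∷ l) ≡ indicator v l
  indicator-∷ {v} {x} v≢x with v ≟ᶠ x
  ... | yes v≡x = ⊥-elim (v≢x v≡x)
  ... | no _    = refl

  indicator-∈ : ∀ {v l} → v ∈ l → indicator v l ≡ 1ℚ
  indicator-∈ {v} {l} v∈l with v ∈? l
  ... | yes _  = refl
  ... | no v∉l = ⊥-elim (v∉l v∈l)

  indicator-∉ : ∀ {v l} → v ∉ l → indicator v l ≡ 0ℚ
  indicator-∉ {v} {l} v∉l with v ∈? l
  ... | yes v∈l = ⊥-elim (v∉l v∈l)
  ... | no _    = refl

  module Rooted (α : Fin n) where

    toRoot : Fin n → List (Fin n)
    toRoot i = path i α

    parentEdge : Fin n → ℚ
    parentEdge v = firstEdge (toRoot v)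

    onPath : Fin n → Fin n → ℚ
    onPath v i = indicator v (toRoot i)

    shared : Fin n → Fin n → ℚ
    shared i j = ∑[ v < n ] (parentEdge v * (onPath v i * onPath v j))

    -- twice the Gromov product (i | j)_α
    gromov : Fin n → Fin n → ℚ
    gromov i j = d i α + d α j - d i j

    parentEdge-nonneg : ∀ v → 0ℚ ≤ parentEdge v
    parentEdge-nonneg v = firstEdge-nonneg (path-simple v α)

    shared-sym : ∀ i j → shared i j ≡ shared j i
    shared-sym i j = sum-cong-≗ λ v → cong (parentEdge v *_) (ℚ.*-comm (onPath v i) (onPath v j))

    shared-root : ∀ j → shared α j ≡ 0ℚ
    shared-root j = trans (sum-cong-≗ term) (sum-replicate-zero n)
      where
      open ≡-Reasoning
      toRoot-α : toRoot α ≡ [ α ]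
      toRoot-α = sym (path-unique stop)
      term : ∀ v → parentEdge v * (onPath v α * onPath v j) ≡ 0ℚ
      term v with v ≟ᶠ α
      ... | yes refl = trans (cong (λ l → firstEdge l * (onPath α α * onPath α j)) toRoot-α)
                             (ℚ.*-zeroˡ (onPath α α * onPath α j))
      ... | no v≢α   = begin
        parentEdge v * (indicator v (toRoot α) * onPath v j)
          ≡⟨ cong (λ l → parentEdge v * (indicator v l * onPath v j)) toRoot-α ⟩
        parentEdge v * (indicator v [ α ] * onPath v j)
          ≡⟨ cong (λ x → parentEdge v * (x * onPath v j)) (indicator-∉ (v≢α ∘ singleton⁻)) ⟩
        parentEdge v * (0ℚ * onPath v j)
          ≡⟨ cong (parentEdge v *_) (ℚ.*-zeroˡ (onPath v j)) ⟩
        parentEdge v * 0ℚ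
          ≡⟨ ℚ.*-zeroʳ (parentEdge v) ⟩
        0ℚ ∎

    path⊆toRoots : ∀ {x l j r} → SimplePath x α l → SimplePath j x r →
                   ∀ {v} → v ∈ r → v ∈ toRoot j ⊎ v ∈ l
    path⊆toRoots stop R v∈r = inj₁ (subst (_ ∈_) (path-unique R) v∈r)
    path⊆toRoots {x} {j = j} (step {b = x′} xx′ _ X′) R {v} v∈r with x ∈? path j x′
    ... | yes x∈q with splitAt (path-simple j x′) x∈q
    ...   | _ , _ , A , _ , A⊆q , _ =
            Sum.map₂ there (path⊆toRoots X′ (path-simple j x′) (A⊆q (subst (v ∈_) (simplePath-unique R A) v∈r)))
    path⊆toRoots {x} {j = j} (step {b = x′} xx′ _ X′) R {v} v∈r | no x∉q
      with extend (path-simple j x′) (adj-sym x x′ xx′) x∉q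
    ... | _ , J , L⊆q∪x , _ with L⊆q∪x (subst (v ∈_) (simplePath-unique R J) v∈r)
    ...   | inj₁ v∈q  = Sum.map₂ there (path⊆toRoots X′ (path-simple j x′) v∈q)
    ...   | inj₂ refl = inj₂ (here refl)

    module ParentEdge {i i′ l} (ii′ : Adj i i′) (i∉l : i ∉ l) (P′ : SimplePath i′ α l) where

      toRoot-i : toRoot i ≡ i ∷ l
      toRoot-i = sym (path-unique (step ii′ i∉l P′))

      toRoot-i′ : toRoot i′ ≡ l
      toRoot-i′ = sym (path-unique P′)

      d-i-α : d i α ≡ w i i′ + d i′ α
      d-i-α = d-step ii′ i∉l P′

      d-below : ∀ {j} → i ∈ toRoot j → d i′ j ≡ d i j + w i i′
      d-below {j} i∈ with splitAt (path-simple j α) i∈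
      ... | _ , _ , _ , B , _ , B⊆ , _ = begin
        d i′ j                              ≡⟨ d-sym i′ j ⟩
        d j i′                              ≡⟨ solve 2 (λ x a → x := x :+ a :- a) refl (d j i′) (d i′ α) ⟩
        d j i′ + d i′ α - d i′ α            ≡⟨ cong (_- d i′ α) (d-split (path-simple j α) i′∈) ⟨
        d j α - d i′ α                      ≡⟨ cong (_- d i′ α) (d-split (path-simple j α) i∈) ⟩
        d j i + d i α - d i′ α              ≡⟨ cong (λ x → d j i + x - d i′ α) d-i-α ⟩
        d j i + (w i i′ + d i′ α) - d i′ α  ≡⟨ solve 3 (λ x W a → x :+ (W :+ a) :- a := x :+ W)
                                                         refl (d j i) (w i i′) (d i′ α) ⟩
        d j i + w i i′                      ≡⟨ cong (_+ w i i′) (d-sym j i) ⟩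
        d i j + w i i′                      ∎
        where
        open ≡-Reasoning
        open +-*-Solver
        i′∈ : i′ ∈ toRoot j
        i′∈ = B⊆ (subst (i′ ∈_) (simplePath-unique (step ii′ i∉l P′) B) (there (source∈ P′)))

      d-not-below : ∀ {j} → i ∉ toRoot j → d i j ≡ w i i′ + d i′ j
      d-not-below {j} i∉ with i ∈? path j i′
      ... | yes i∈q = ⊥-elim (Sum.[ i∉ , i∉l ]′ (path⊆toRoots P′ (path-simple j i′) i∈q))
      ... | no i∉q with extend (path-simple j i′) (adj-sym i i′ ii′) i∉q
      ...   | L , J , _ , weight-L = begin
        d i j                        ≡⟨ d-sym i j ⟩
        d j i                        ≡⟨ d≡weight J ⟩
        weight L                     ≡⟨ weight-L ⟩
        weight (path j i′) + w i′ i  ≡⟨ cong₂ _+_ (sym (d≡weight (path-simple j i′)))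
                                                  (w-sym i′ i (adj-sym i i′ ii′)) ⟩
        d j i′ + w i i′              ≡⟨ ℚ.+-comm (d j i′) (w i i′) ⟩
        w i i′ + d j i′              ≡⟨ cong (w i i′ +_) (d-sym j i′) ⟩
        w i i′ + d i′ j              ∎
        where open ≡-Reasoning

      shared-step : ∀ j → shared i j ≡ w i i′ * onPath i j + shared i′ j
      shared-step j = begin
        shared i j                                   ≡⟨ sum-cong-≗ term ⟩
        ∑[ v < n ] (diagonal g v i + parentEdge v * (onPath v i′ * onPath v j))
                                                     ≡⟨ ∑-distrib-+ (λ v → diagonal g v i) _ ⟩
        ∑[ v < n ] diagonal g v i + shared i′ j      ≡⟨ cong (_+ shared i′ j) (∑-diagonal g i) ⟩
        parentEdge i * onPath i j + shared i′ j      ≡⟨ cong (λ c → c * onPath i j + shared i′ j) parentEdge-i ⟩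
        w i i′ * onPath i j + shared i′ j            ∎
        where
        open ≡-Reasoning
        open +-*-Solver
        g : Fin n → ℚ
        g v = parentEdge v * onPath v j
        parentEdge-i : parentEdge i ≡ w i i′
        parentEdge-i = trans (cong firstEdge toRoot-i) (firstEdge-step P′)
        term : ∀ v → parentEdge v * (onPath v i * onPath v j) ≡
                     diagonal g v i + parentEdge v * (onPath v i′ * onPath v j)
        term v with v ≟ᶠ i
        ... | yes refl = begin
          parentEdge i * (onPath i i * onPath i j)
            ≡⟨ cong (λ x → parentEdge i * (x * onPath i j)) (indicator-∈ (source∈ (path-simple i α))) ⟩
          parentEdge i * (1ℚ * onPath i j)
            ≡⟨ solve 2 (λ c b → c :* (con 1ℚ :* b) := c :* b :+ c :* (con 0ℚ :* b))
                       refl (parentEdge i) (onPath i j) ⟩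
          parentEdge i * onPath i j + parentEdge i * (0ℚ * onPath i j)
            ≡⟨ cong (λ x → parentEdge i * onPath i j + parentEdge i * (x * onPath i j))
                    (indicator-∉ (subst (i ∉_) (sym toRoot-i′) i∉l)) ⟨
          parentEdge i * onPath i j + parentEdge i * (onPath i i′ * onPath i j) ∎
        ... | no v≢i = begin
          parentEdge v * (onPath v i * onPath v j)
            ≡⟨ cong (λ x → parentEdge v * (x * onPath v j)) onPath-v-i ⟩
          parentEdge v * (onPath v i′ * onPath v j)
            ≡⟨ ℚ.+-identityˡ _ ⟨
          0ℚ + parentEdge v * (onPath v i′ * onPath v j) ∎
          where
          onPath-v-i : onPath v i ≡ onPath v i′
          onPath-v-i = begin
            indicator v (toRoot i)  ≡⟨ cong (indicator v) toRoot-i ⟩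
            indicator v (i ∷ l)     ≡⟨ indicator-∷ {l = l} v≢i ⟩
            indicator v l           ≡⟨ cong (indicator v) toRoot-i′ ⟨
            indicator v (toRoot i′) ∎

      gromov-step : ∀ j → gromov i j ≡ gromov i′ j + (w i i′ * onPath i j + w i i′ * onPath i j)
      gromov-step j = by-side (i ∈? toRoot j)
        where
        open ≡-Reasoning
        open +-*-Solver
        W : ℚ
        W = w i i′
        by-side : Dec (i ∈ toRoot j) → gromov i j ≡ gromov i′ j + (W * onPath i j + W * onPath i j)
        by-side (yes i∈) = begin
          d i α + d α j - d i j
            ≡⟨ cong (λ x → x + d α j - d i j) d-i-α ⟩
          W + d i′ α + d α j - d i j
            ≡⟨ solve 4 (λ W a e x → W :+ a :+ e :- x := a :+ e :- (x :+ W) :+ (W :* con 1ℚ :+ W :* con 1ℚ))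
                       refl W (d i′ α) (d α j) (d i j) ⟩
          d i′ α + d α j - (d i j + W) + (W * 1ℚ + W * 1ℚ)
            ≡⟨ cong₂ (λ x b → d i′ α + d α j - x + (W * b + W * b)) (d-below i∈) (indicator-∈ i∈) ⟨
          gromov i′ j + (W * onPath i j + W * onPath i j) ∎
        by-side (no i∉) = begin
          d i α + d α j - d i j
            ≡⟨ cong₂ (λ x y → x + d α j - y) d-i-α (d-not-below i∉) ⟩
          W + d i′ α + d α j - (W + d i′ j)
            ≡⟨ solve 4 (λ W a e y → W :+ a :+ e :- (W :+ y) := a :+ e :- y :+ (W :* con 0ℚ :+ W :* con 0ℚ))
                       refl W (d i′ α) (d α j) (d i′ j) ⟩
          gromov i′ j + (W * 0ℚ + W * 0ℚ)
            ≡⟨ cong (λ b → gromov i′ j + (W * b + W * b)) (indicator-∉ i∉) ⟨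
          gromov i′ j + (W * onPath i j + W * onPath i j) ∎

    gromov≡shared : ∀ i j → gromov i j ≡ shared i j + shared i j
    gromov≡shared i = along (path-simple i α)
      where
      open ≡-Reasoning
      open +-*-Solver
      along : ∀ {i l} → SimplePath i α l → ∀ j → gromov i j ≡ shared i j + shared i j
      along stop j = begin
        d α α + d α j - d α j    ≡⟨ cong (λ x → x + d α j - d α j) (d-self α) ⟩
        0ℚ + d α j - d α j       ≡⟨ solve 1 (λ x → con 0ℚ :+ x :- x := con 0ℚ :+ con 0ℚ) refl (d α j) ⟩
        0ℚ + 0ℚ                  ≡⟨ cong₂ _+_ (shared-root j) (shared-root j) ⟨
        shared α j + shared α j  ∎
      along {i} (step {b = i′} ii′ i∉l P′) j = begin
        gromov i j                    ≡⟨ gromov-step j ⟩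
        gromov i′ j + (Wb + Wb)       ≡⟨ cong (_+ (Wb + Wb)) (along P′ j) ⟩
        shared i′ j + shared i′ j + (Wb + Wb)
          ≡⟨ solve 2 (λ s x → s :+ s :+ (x :+ x) := (x :+ s) :+ (x :+ s)) refl (shared i′ j) Wb ⟩
        (Wb + shared i′ j) + (Wb + shared i′ j)
          ≡⟨ cong₂ _+_ (shared-step j) (shared-step j) ⟨
        shared i j + shared i j       ∎
        where
        open ParentEdge ii′ i∉l P′
        Wb : ℚ
        Wb = w i i′ * onPath i j

module OnComponent {m} {Adj : Fin (suc (suc m)) → Fin (suc (suc m)) → Set}
                   {w : Fin (suc (suc m)) → Fin (suc (suc m)) → ℚ}
                   (tree : IsWeightedTree Adj w) (d : Fin (suc (suc m)) → Fin (suc (suc m)) → ℚ)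
                   (d-realised : ∀ i j → ∃ λ p → Path Adj i j p × pathWeight w p ≡ d i j)
                   {α p₁₂} (P₁₂ : Path Adj v₁ v₂ p₁₂) (α∈p₁₂ : α ∈ p₁₂)
                   {C} (component : IsComponentMinus Adj α C) (¬C₁ : ¬ C v₁) (¬C₂ : ¬ C v₂) where
  open import Data.Rational using (_+_)
  open QuadraticForms
  open SimplePaths Adj w using (path⇒simplePath)
  open TreeMetric tree d d-realised
  open Rooted α

  rowSum : Fin (suc (suc m)) → ℚ
  rowSum i = sumFin (d i)

  R′ : Fin (suc (suc m)) → Fin (suc (suc m)) → ℚ
  R′ i j = (shared i j + shared i j) + diagonal rowSum i j

  R′-symmetric : ∀ i j → R′ i j ≡ R′ j i
  R′-symmetric i j = cong₂ _+_ (cong₂ _+_ (shared-sym i j) (shared-sym i j)) (diagonal-sym rowSum i j)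

  R′-psd : PositiveSemidefinite R′
  R′-psd = psd-+ {M = λ i j → shared i j + shared i j} {N = diagonal rowSum}
                 (psd-+ {M = shared} {N = shared} shared-psd shared-psd)
                 (diagonal-psd rowSum rowSum-nonneg)
    where
    shared-psd : PositiveSemidefinite shared
    shared-psd = gram-psd parentEdge onPath parentEdge-nonneg
    rowSum-nonneg : ∀ i → 0ℚ ≤ rowSum i
    rowSum-nonneg i = subst (0ℚ ≤_) (sym (sumFin≡sum (d i))) (sum-nonneg (d i) (d-nonneg i))

  Rmat-split : ∀ i j → Rmat d i j ≡ ((- d v₂ v₁) + d i v₁ + d v₂ j - d i j) + diagonal rowSum i j
  Rmat-split i j with i ≟ᶠ j
  ... | yes refl = cong (_+ rowSum i) (sym (trans (cong (λ x → (- d v₂ v₁) + d i v₁ + d v₂ i - x) (d-self i))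
                                                  (ℚ.+-identityʳ ((- d v₂ v₁) + d i v₁ + d v₂ i))))
  ... | no _     = sym (ℚ.+-identityʳ ((- d v₂ v₁) + d i v₁ + d v₂ j - d i j))

  Rmat≡R′ : ∀ {i j} → C i → C j → Rmat d i j ≡ R′ i j
  Rmat≡R′ {i} {j} Ci Cj =
    trans (Rmat-split i j) (cong (_+ diagonal rowSum i j) (trans outer≡gromov (gromov≡shared i j)))
    where
    open ≡-Reasoning
    open +-*-Solver
    d₂₁ : d v₂ v₁ ≡ d α v₁ + d v₂ α
    d₂₁ = trans (d-sym v₂ v₁) (trans (d-split (path⇒simplePath p₁₂ P₁₂) α∈p₁₂)
                                     (cong₂ _+_ (d-sym v₁ α) (d-sym α v₂)))
    d₂ⱼ : d v₂ j ≡ d α j + d v₂ α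
    d₂ⱼ = trans (d-sym v₂ j) (trans (d-through-cut component Cj ¬C₂) (cong₂ _+_ (d-sym j α) (d-sym α v₂)))
    outer≡gromov : (- d v₂ v₁) + d i v₁ + d v₂ j - d i j ≡ gromov i j
    outer≡gromov = begin
      (- d v₂ v₁) + d i v₁ + d v₂ j - d i j
        ≡⟨ cong₂ (λ x y → (- x) + y + d v₂ j - d i j) d₂₁ (d-through-cut component Ci ¬C₁) ⟩
      (- (d α v₁ + d v₂ α)) + (d i α + d α v₁) + d v₂ j - d i j
        ≡⟨ cong (λ x → (- (d α v₁ + d v₂ α)) + (d i α + d α v₁) + x - d i j) d₂ⱼ ⟩
      (- (d α v₁ + d v₂ α)) + (d i α + d α v₁) + (d α j + d v₂ α) - d i j
        ≡⟨ solve 5 (λ a₁ a₂ x y z → (:- (a₁ :+ a₂)) :+ (x :+ a₁) :+ (y :+ a₂) :- z := x :+ y :- z)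
                   refl (d α v₁) (d v₂ α) (d i α) (d α j) (d i j) ⟩
      gromov i j ∎

open import Data.Nat using (_+_)

lemma3p4 : (m : ℕ) →
    (Adj : Fin (3 + m) → Fin (3 + m) → Set) (w : Fin (3 + m) → Fin (3 + m) → ℚ) →
    IsWeightedTree Adj w →
    (d : Fin (3 + m) → Fin (3 + m) → ℚ) →
    (∀ i j → ∃ λ p → Path Adj i j p × pathWeight w p ≡ d i j) →
    (α : Fin (3 + m)) → (∃ λ p → Path Adj v₁ v₂ p × α ∈ p) →
    (C : Fin (3 + m) → Set) → IsComponentMinus Adj α C → ¬ C v₁ → ¬ C v₂ →
    (u : Fin (3 + m)) → C u → Adj u α →
    (E : Subset (3 + m)) → (∀ x → x ∈ₛ E → C x) → u ∈ₛ E → SpansConnected Adj E →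
    SymmetricOn E (Rmat d) × PSDOn E (Rmat d)
lemma3p4 m Adj w tree d d-realised α (_ , P₁₂ , α∈p₁₂) C component ¬C₁ ¬C₂ _ _ _ E E⊆C _ _ =
  symmetricOn-restrict Rmat≡R′-on-E R′-symmetric , psdOn-restrict Rmat≡R′-on-E R′-psd
  where
  open QuadraticForms using (symmetricOn-restrict; psdOn-restrict)
  open OnComponent tree d d-realised P₁₂ α∈p₁₂ component ¬C₁ ¬C₂
  Rmat≡R′-on-E : ∀ i j → i ∈ₛ E → j ∈ₛ E → Rmat d i j ≡ R′ i j
  Rmat≡R′-on-E i j i∈E j∈E = Rmat≡R′ (E⊆C i i∈E) (E⊆C j j∈E)
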